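{- Let $p/q$ be a rational number in the triadic Cantor set $\mathcal{K}$ with prelength $\ell$ and period $m$, so that its 3-adic expansion is $p/q=[\epsilon_1,\dots,\epsilon_\ell,(w_1,\dots,w_m)^\infty]$ with all digits in $\{0,2\}$. Let $$p_{\mathrm{int}}=3^{\ell+m}[\epsilon_1,\dots,\epsilon_\ell,w_1,\dots,w_m]-3^{\ell}[\epsilon_1,\dots,\epsilon_\ell],\qquad q_{\mathrm{int}}=3^{\ell}(3^m-1).$$ Then $\gcd(p_{\mathrm{int}},3^{\ell})=1$ and $\gcd(p_{\mathrm{int}},q_{\mathrm{int}})=\gcd\big(3^m[w_1,\dots,w_m],\,3^m-1\big)$.
   Context: Every point of $\mathcal{K}$ has a unique 3-adic expansion with digits in $\{0,2\}$. Notation: $[a_1,\dots,a_j]=\sum_{i=1}^j a_i3^{ -i}$, and $[\epsilon_1,\dots,\epsilon_\ell,(w_1,\dots,w_m)^\infty]$ denotes the number whose digit sequence is $\epsilon_1,\dots,\epsilon_\ell$ followed by the block $w_1,\dots,w_m$ repeated forever. For a rational $p/q\in\mathcal{K}$ with digit sequence $(\epsilon_i)$, the prelength $\ell\ge0$ is the smallest integer such that $(\epsilon_i)_{i>\ell}$ is purely periodic, and the period $m$ is the smallest period of $(\epsilon_i)_{i>\ell}$. One has $p/q=p_{\mathrm{int}}/q_{\mathrm{int}}$ with $p_{\mathrm{int}},q_{\mathrm{int}}$ integers. -}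

module Defs where

open import Data.Nat using (ℕ; zero; suc; _+_; _*_; _≤_)
open import Data.Product using (Σ; _×_)
open import Data.Sum using (_⊎_)
open import Relation.Binary.PropositionalEquality using (_≡_)

-- A digit sequence: the (i+1)-th 3-adic digit ε_{i+1} is  d i  (0-indexed).
DigitSeq : Set
DigitSeq = ℕ → ℕ

CantorDigits : DigitSeq → Set
CantorDigits d = ∀ i → d i ≡ 0 ⊎ d i ≡ 2

PeriodicFrom : DigitSeq → ℕ → ℕ → Set
PeriodicFrom d ℓ m = (1 ≤ m) × (∀ i → d (ℓ + i + m) ≡ d (ℓ + i))

IsPrelength : DigitSeq → ℕ → Set
IsPrelength d ℓ =
  Σ ℕ (λ m → PeriodicFrom d ℓ m) ×
  (∀ ℓ' m' → PeriodicFrom d ℓ' m' → ℓ ≤ ℓ')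

IsPeriod : DigitSeq → ℕ → ℕ → Set
IsPeriod d ℓ m = PeriodicFrom d ℓ m × (∀ m' → PeriodicFrom d ℓ m' → m ≤ m')

-- block d a n = 3^n [d a, d (a+1), …, d (a+n-1)]
--             = Σ_{i<n} d(a+i) 3^{n-1-i}   (a natural number).
-- In particular, in the paper's notation (digits ε_{i+1} = d i):
--   block d 0 j   = 3^j [ε_1,…,ε_j],
--   block d ℓ m   = 3^m [w_1,…,w_m]   where w_k = ε_{ℓ+k}.
block : DigitSeq → ℕ → ℕ → ℕ
block d a zero    = 0
block d a (suc n) = block d a n * 3 + d (a + n)

{-# OPTIONS --safe #-}
module Submission where

-- Write A = 3^ℓ[ε₁,…,ε_ℓ] and W = 3^m[w₁,…,w_m]. Concatenating digit blocks gives
-- p_int = A(3^m − 1) + W. The last digits of A and of A·3^m + W are ε_ℓ and w_m, so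
-- 3 ∣ p_int forces ε_ℓ ≡ w_m (mod 3), hence ε_ℓ = w_m as both lie in {0,2}; the periodic
-- tail would then already start at ℓ − 1, contradicting minimality of the prelength.
-- So p_int is coprime to 3^ℓ, and gcd(p_int, 3^ℓ(3^m − 1)) = gcd(A(3^m − 1) + W, 3^m − 1)
-- = gcd(W, 3^m − 1).

open import Defs
open import Data.Nat using (ℕ; zero; suc; _+_; _*_; _∸_; _^_; _≤_; _%_; NonZero)
open import Data.Nat.Properties
open import Data.Nat.DivMod using ([m+kn]%n≡m%n)
open import Data.Nat.Divisibility
open import Data.Nat.GCD using (gcd; gcd-universality; gcd-greatest; gcd[m,n]∣m; gcd[m,n]∣n)
open import Data.Nat.Coprimality using (Coprime; coprime⇒gcd≡1; coprime-divisor; coprime-factors)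
open import Data.Nat.Primality using (Prime; prime?; prime⇒irreducible)
open import Data.Product using (_×_; _,_)
open import Data.Sum using (_⊎_; inj₁; inj₂)
open import Data.Empty using (⊥-elim)
open import Relation.Nullary using (¬_)
open import Relation.Nullary.Decidable using (toWitness)
open import Relation.Binary.PropositionalEquality
open import Data.Nat.Tactic.RingSolver using (solve-∀)

private variable
  d : DigitSeq
  k m n ℓ : ℕ

∣∸⇒%≡ : .{{_ : NonZero k}} → n ≤ m → k ∣ m ∸ n → m % k ≡ n % k
∣∸⇒%≡ {k} {n} {m} n≤m (divides q m∸n≡q*k) = begin
  m % k               ≡⟨ cong (_% k) (sym (m+[n∸m]≡n n≤m)) ⟩
  (n + (m ∸ n)) % k   ≡⟨ cong (λ t → (n + t) % k) m∸n≡q*k ⟩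
  (n + q * k) % k     ≡⟨ [m+kn]%n≡m%n n q k ⟩
  n % k               ∎
  where open ≡-Reasoning

coprime-^ : ∀ {p} → Prime p → ¬ p ∣ n → ∀ k → Coprime n (p ^ k)
coprime-^ _ _ zero (_ , c∣1) = ∣1⇒≡1 c∣1
coprime-^ {n} {p} pr p∤n (suc k) {c} (c∣n , c∣p^[1+k]) =
  coprime-^ pr p∤n k (c∣n , coprime-divisor c⊥p c∣p^[1+k])
  where
  c⊥p : Coprime c p
  c⊥p (e∣c , e∣p) with prime⇒irreducible pr e∣p
  ... | inj₁ e≡1 = e≡1
  ... | inj₂ refl = ⊥-elim (p∤n (∣-trans e∣c c∣n))

gcd-*ʳ-coprime : ∀ {a} → Coprime a k → gcd a (k * n) ≡ gcd a n
gcd-*ʳ-coprime {k} {n} {a} a⊥k = gcd-universality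
  (λ (c∣a , c∣n) → gcd-greatest c∣a (∣n⇒∣m*n k c∣n))
  (λ c∣g → let c∣a = ∣-trans c∣g (gcd[m,n]∣m a (k * n)) in
    c∣a , coprime-factors a⊥k (∣m⇒∣m*n n c∣a , ∣-trans c∣g (gcd[m,n]∣n a (k * n))))

gcd[a*n+b,n]≡gcd[b,n] : ∀ a b n → gcd (a * n + b) n ≡ gcd b n
gcd[a*n+b,n]≡gcd[b,n] a b n = gcd-universality
  (λ (c∣b , c∣n) → gcd-greatest (∣m∣n⇒∣m+n (∣n⇒∣m*n a c∣n) c∣b) c∣n)
  (λ c∣g → let c∣n = ∣-trans c∣g (gcd[m,n]∣n (a * n + b) n) in
    ∣m+n∣m⇒∣n (∣-trans c∣g (gcd[m,n]∣m (a * n + b) n)) (∣n⇒∣m*n a c∣n) , c∣n)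

numerator : DigitSeq → ℕ → ℕ → ℕ
numerator d ℓ m = block d 0 (ℓ + m) ∸ block d 0 ℓ

block-++ : ∀ d a n k → block d a (n + k) ≡ block d a n * 3 ^ k + block d (a + n) k
block-++ d a n zero = begin
  block d a (n + 0)                  ≡⟨ cong (block d a) (+-identityʳ n) ⟩
  block d a n                        ≡⟨ sym (*-identityʳ _) ⟩
  block d a n * 1                    ≡⟨ sym (+-identityʳ _) ⟩
  block d a n * 1 + 0                ∎
  where open ≡-Reasoning
block-++ d a n (suc k) = begin
  block d a (n + suc k)                    ≡⟨ cong (block d a) (+-suc n k) ⟩
  block d a (n + k) * 3 + d (a + (n + k))  ≡⟨ cong₂ (λ x i → x * 3 + d i) (block-++ d a n k) (sym (+-assoc a n k)) ⟩
  (B * 3 ^ k + C) * 3 + x                  ≡⟨ regroup B C x (3 ^ k) ⟩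
  B * 3 ^ suc k + (C * 3 + x)              ∎
  where
  open ≡-Reasoning
  B = block d a n
  C = block d (a + n) k
  x = d (a + n + k)
  regroup : ∀ B C x t → (B * t + C) * 3 + x ≡ B * (3 * t) + (C * 3 + x)
  regroup = solve-∀

block-prefix-≤ : ∀ d a n k → block d a n ≤ block d a (n + k)
block-prefix-≤ d a n k = begin
  block d a n                             ≤⟨ m≤m*n (block d a n) (3 ^ k) {{m^n≢0 3 k}} ⟩
  block d a n * 3 ^ k                     ≤⟨ m≤m+n _ _ ⟩
  block d a n * 3 ^ k + block d (a + n) k ≡⟨ sym (block-++ d a n k) ⟩
  block d a (n + k)                       ∎
  where open ≤-Reasoning

numerator≡ : ∀ d ℓ m → numerator d ℓ m ≡ block d 0 ℓ * (3 ^ m ∸ 1) + block d ℓ m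
numerator≡ d ℓ m = begin
  block d 0 (ℓ + m) ∸ A       ≡⟨ cong (_∸ A) (block-++ d 0 ℓ m) ⟩
  (A * 3 ^ m + W) ∸ A         ≡⟨ +-∸-comm W (m≤m*n A (3 ^ m) {{m^n≢0 3 m}}) ⟩
  (A * 3 ^ m ∸ A) + W         ≡⟨ cong (λ t → (A * 3 ^ m ∸ t) + W) (sym (*-identityʳ A)) ⟩
  (A * 3 ^ m ∸ A * 1) + W     ≡⟨ cong (_+ W) (sym (*-distribˡ-∸ A (3 ^ m) 1)) ⟩
  A * (3 ^ m ∸ 1) + W         ∎
  where
  open ≡-Reasoning
  A = block d 0 ℓ
  W = block d ℓ m

block-last-digit : ∀ d a n → block d a (suc n) % 3 ≡ d (a + n) % 3
block-last-digit d a n = begin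
  (block d a n * 3 + d (a + n)) % 3 ≡⟨ cong (_% 3) (+-comm (block d a n * 3) (d (a + n))) ⟩
  (d (a + n) + block d a n * 3) % 3 ≡⟨ [m+kn]%n≡m%n (d (a + n)) (block d a n) 3 ⟩
  d (a + n) % 3                     ∎
  where open ≡-Reasoning

cantor-digit-≡ : ∀ {x y} → x ≡ 0 ⊎ x ≡ 2 → y ≡ 0 ⊎ y ≡ 2 → x % 3 ≡ y % 3 → x ≡ y
cantor-digit-≡ (inj₁ refl) (inj₁ refl) _  = refl
cantor-digit-≡ (inj₁ refl) (inj₂ refl) ()
cantor-digit-≡ (inj₂ refl) (inj₁ refl) ()
cantor-digit-≡ (inj₂ refl) (inj₂ refl) _  = refl

periodicFrom-pred : PeriodicFrom d (suc ℓ) m → d (ℓ + m) ≡ d ℓ → PeriodicFrom d ℓ m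
periodicFrom-pred {d} {ℓ} {m} (1≤m , periodic) wrap = 1≤m , shifted
  where
  shifted : ∀ i → d (ℓ + i + m) ≡ d (ℓ + i)
  shifted zero    rewrite +-identityʳ ℓ = wrap
  shifted (suc i) rewrite +-suc ℓ i = periodic i

3∤numerator : CantorDigits d → IsPrelength d (suc ℓ) → PeriodicFrom d (suc ℓ) m →
              ¬ 3 ∣ numerator d (suc ℓ) m
3∤numerator {d} {ℓ} {suc m} digits (_ , minimal) periodic 3∣p =
  n≮n ℓ (minimal ℓ (suc m) (periodicFrom-pred {d} periodic wrap))
  where
  wrap : d (ℓ + suc m) ≡ d ℓ
  wrap = cantor-digit-≡ (digits _) (digits ℓ) (begin
    d (ℓ + suc m) % 3             ≡⟨ sym (block-last-digit d 0 (ℓ + suc m)) ⟩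
    block d 0 (suc ℓ + suc m) % 3 ≡⟨ ∣∸⇒%≡ (block-prefix-≤ d 0 (suc ℓ) (suc m)) 3∣p ⟩
    block d 0 (suc ℓ) % 3         ≡⟨ block-last-digit d 0 ℓ ⟩
    d ℓ % 3                       ∎)
    where open ≡-Reasoning

numerator-coprime-3^ℓ : CantorDigits d → IsPrelength d ℓ → PeriodicFrom d ℓ m →
                        Coprime (numerator d ℓ m) (3 ^ ℓ)
numerator-coprime-3^ℓ {ℓ = zero}  _ _ _ (_ , c∣1) = ∣1⇒≡1 c∣1
numerator-coprime-3^ℓ {ℓ = suc ℓ} digits prelength periodic =
  coprime-^ (toWitness {a? = prime? 3} _) (3∤numerator digits prelength periodic) (suc ℓ)

lemma6p1 : (d : DigitSeq) (ℓ m : ℕ) →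
    CantorDigits d → IsPrelength d ℓ → IsPeriod d ℓ m →
    (gcd (block d 0 (ℓ + m) ∸ block d 0 ℓ) (3 ^ ℓ) ≡ 1) ×
    (gcd (block d 0 (ℓ + m) ∸ block d 0 ℓ) (3 ^ ℓ * (3 ^ m ∸ 1))
      ≡ gcd (block d ℓ m) (3 ^ m ∸ 1))
lemma6p1 d ℓ m digits prelength (periodic , _) = coprime⇒gcd≡1 p⊥3^ℓ , (begin
  gcd (numerator d ℓ m) (3 ^ ℓ * (3 ^ m ∸ 1))    ≡⟨ gcd-*ʳ-coprime p⊥3^ℓ ⟩
  gcd (numerator d ℓ m) (3 ^ m ∸ 1)              ≡⟨ cong (λ p → gcd p (3 ^ m ∸ 1)) (numerator≡ d ℓ m) ⟩
  gcd (block d 0 ℓ * (3 ^ m ∸ 1) + block d ℓ m) (3 ^ m ∸ 1)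
                                                 ≡⟨ gcd[a*n+b,n]≡gcd[b,n] (block d 0 ℓ) (block d ℓ m) (3 ^ m ∸ 1) ⟩
  gcd (block d ℓ m) (3 ^ m ∸ 1)                  ∎)
  where
  open ≡-Reasoning
  p⊥3^ℓ : Coprime (numerator d ℓ m) (3 ^ ℓ)
  p⊥3^ℓ = numerator-coprime-3^ℓ digits prelength periodic
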